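{- Let $G$ be a connected graph of order at least three. Then $\gamma(G)=\gamma_{\rm cer}(G)$ if and only if $G$ has a $\gamma$-set $D$ such that every vertex in $D$ has at least two neighbors in $V_G-D$.
   Context: All graphs are finite and simple. A set $D\subseteq V_G$ is a dominating set of $G$ if every vertex of $V_G-D$ is adjacent to at least one vertex of $D$; $\gamma(G)$ is the minimum cardinality of a dominating set, and a $\gamma$-set is a dominating set of cardinality $\gamma(G)$. A set $D\subseteq V_G$ is a certified dominating set of $G$ if $D$ is a dominating set of $G$ and every vertex in $D$ has either zero or at least two neighbors in $V_G-D$; $\gamma_{\rm cer}(G)$ is the minimum cardinality of a certified dominating set of $G$. -}

module Defs where

open import Data.Nat using (ℕ; _≤_; _≥_)
open import Data.Bool using (Bool; true; false; T; _∧_)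
open import Data.Fin using (Fin)
open import Data.Fin.Subset using (Subset; _∈_; _∉_; ∣_∣; ∁; _∩_)
open import Data.Vec using (tabulate)
open import Data.Product using (Σ; _×_; ∃)
open import Data.Sum using (_⊎_)
open import Relation.Binary.PropositionalEquality using (_≡_)

record Graph (n : ℕ) : Set where
  field
    adj     : Fin n → Fin n → Bool
    sym     : ∀ u v → adj u v ≡ adj v u
    irrefl  : ∀ v → adj v v ≡ false
open Graph public

Order : ∀ {n} → Graph n → ℕ
Order {n} _ = n

Adj : ∀ {n} → Graph n → Fin n → Fin n → Set
Adj G u v = T (adj G u v)

data Reach {n} (G : Graph n) : Fin n → Fin n → Set where
  here : ∀ {v} → Reach G v v
  step : ∀ {u v w} → Adj G u v → Reach G v w → Reach G u w

Connected : ∀ {n} → Graph n → Set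
Connected {n} G = ∀ (u v : Fin n) → Reach G u v

N : ∀ {n} → Graph n → Fin n → Subset n
N G v = tabulate (λ u → adj G v u)

outDeg : ∀ {n} → Graph n → Subset n → Fin n → ℕ
outDeg G D v = ∣ N G v ∩ ∁ D ∣

Dominating : ∀ {n} → Graph n → Subset n → Set
Dominating {n} G D = ∀ (v : Fin n) → v ∉ D → ∃ λ u → u ∈ D × Adj G u v

Certified : ∀ {n} → Graph n → Subset n → Set
Certified {n} G D =
  Dominating G D × (∀ (v : Fin n) → v ∈ D → outDeg G D v ≡ 0 ⊎ outDeg G D v ≥ 2)

IsDominationNumber : ∀ {n} → Graph n → ℕ → Set
IsDominationNumber G k =
  (Σ (Subset _) λ D → Dominating G D × ∣ D ∣ ≡ k)
  × (∀ D → Dominating G D → k ≤ ∣ D ∣)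

IsCertifiedDominationNumber : ∀ {n} → Graph n → ℕ → Set
IsCertifiedDominationNumber G k =
  (Σ (Subset _) λ D → Certified G D × ∣ D ∣ ≡ k)
  × (∀ D → Certified G D → k ≤ ∣ D ∣)

IsGammaSet : ∀ {n} → Graph n → Subset n → Set
IsGammaSet G D = Dominating G D × IsDominationNumber G ∣ D ∣

module Submission where

-- A vertex v of a γ-set D cannot have all its neighbours inside D: since G is connected with
-- at least two vertices, v has a neighbour, which then dominates v, so D - v would be a smaller
-- dominating set. Hence in a certified γ-set the alternative "zero outside neighbours" never
-- occurs. Conversely a γ-set with all outside degrees at least 2 is certified, so γ_cer ≤ γ.

open import Defs hiding (sym)
open import Data.Nat using (ℕ; _≤_; _≥_; _<_; s≤s)
open import Data.Nat.Properties using (≤-antisym; ≤-trans; ≤-reflexive; <-irrefl; <⇒≢; n≤1+n)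
open import Data.Fin using (Fin; zero; suc; _≟_)
open import Data.Fin.Subset using (Subset; _∈_; _⊆_; ∣_∣; _-_; ⁅_⁆)
open import Data.Fin.Subset.Properties
  using (_∈?_; x∈⁅y⁆⇒x≡y; ∣⁅x⁆∣≡1; p⊆q⇒∣p∣≤∣q∣; x∈p∩q⁺; x∉p⇒x∈∁p;
         x∈p∧x≢y⇒x∈p-y; x∈p⇒∣p-x∣<∣p∣)
open import Data.Vec.Properties using (lookup⇒[]=; lookup∘tabulate)
open import Data.Bool using (T)
open import Data.Bool.Properties using (T-≡)
open import Data.Product using (Σ; ∃; _×_; _,_; proj₁)
open import Data.Sum using (inj₂; [_,_]′)
open import Function using (id; _∘_)
open import Function.Bundles using (_⇔_; mk⇔; Equivalence)
open import Relation.Nullary using (¬_; yes; no; contradiction)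
open import Relation.Binary.PropositionalEquality using (_≡_; _≢_; refl; sym; trans; subst)

x∈p⇒0<∣p∣ : ∀ {n} {x : Fin n} {p : Subset n} → x ∈ p → 0 < ∣ p ∣
x∈p⇒0<∣p∣ {x = x} x∈p = ≤-trans (≤-reflexive (sym (∣⁅x⁆∣≡1 x))) (p⊆q⇒∣p∣≤∣q∣ ⁅x⁆⊆p)
  where
  ⁅x⁆⊆p : ⁅ x ⁆ ⊆ _
  ⁅x⁆⊆p y∈⁅x⁆ with refl ← x∈⁅y⁆⇒x≡y x y∈⁅x⁆ = x∈p

module _ {n} (G : Graph n) where

  Adj-sym : ∀ {u v} → Adj G u v → Adj G v u
  Adj-sym {u} {v} a = subst T (Graph.sym G u v) a

  Adj-irrefl : ∀ {v} → ¬ Adj G v v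
  Adj-irrefl {v} a = subst T (irrefl G v) a

  Adj⇒∈N : ∀ {v u} → Adj G v u → u ∈ N G v
  Adj⇒∈N {v} {u} a = lookup⇒[]= u _ (trans (lookup∘tabulate _ u) (Equivalence.to T-≡ a))

  connected⇒neighbour : Connected G → 2 ≤ n → ∀ v → ∃ (Adj G v)
  connected⇒neighbour conn (s≤s (s≤s _)) v = first-step (other≢ v) (conn v (other v))
    where
    other : Fin n → Fin n
    other zero    = suc zero
    other (suc _) = zero

    other≢ : ∀ v → other v ≢ v
    other≢ zero    ()
    other≢ (suc _) ()

    first-step : ∀ {w} → w ≢ v → Reach G v w → ∃ (Adj G v)
    first-step w≢v here               = contradiction refl w≢v
    first-step _   (step {v = u} a _) = u , a

  outDeg≡0⇒N⊆ : ∀ {D v} → outDeg G D v ≡ 0 → N G v ⊆ D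
  outDeg≡0⇒N⊆ {D} {v} out≡0 {u} u∈N with u ∈? D
  ... | yes u∈D = u∈D
  ... | no  u∉D = contradiction out≡0
                    (<⇒≢ (x∈p⇒0<∣p∣ (x∈p∩q⁺ (u∈N , x∉p⇒x∈∁p u∉D))) ∘ sym)

  Dominating-remove : ∀ {D v} → Dominating G D → v ∈ D → N G v ⊆ D → ∃ (Adj G v) →
                      Dominating G (D - v)
  Dominating-remove {D} {v} dom v∈D N⊆D (u , v~u) x x∉D-v with x ≟ v
  ... | yes refl = u , x∈p∧x≢y⇒x∈p-y (N⊆D (Adj⇒∈N v~u)) u≢v , Adj-sym v~u
    where
    u≢v : u ≢ v
    u≢v refl = Adj-irrefl v~u
  ... | no x≢v with x ∈? D
  ...   | yes x∈D = contradiction (x∈p∧x≢y⇒x∈p-y x∈D x≢v) x∉D-v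
  ...   | no  x∉D with dom x x∉D
  ...     | y , y∈D , y~x with y ≟ v
  ...       | yes refl = contradiction (N⊆D (Adj⇒∈N y~x)) x∉D
  ...       | no  y≢v  = y , x∈p∧x≢y⇒x∈p-y y∈D y≢v , y~x

  γ-set⇒outDeg≢0 : ∀ {D v} → IsGammaSet G D → v ∈ D → ∃ (Adj G v) → outDeg G D v ≢ 0
  γ-set⇒outDeg≢0 {D} (dom , _ , minimal) v∈D nbr out≡0 =
    <-irrefl refl (≤-trans (s≤s (minimal _ smaller)) (x∈p⇒∣p-x∣<∣p∣ v∈D))
    where
    smaller : Dominating G (D - _)
    smaller = Dominating-remove dom v∈D (outDeg≡0⇒N⊆ out≡0) nbr

  minimum-dominating⇒γ-set : ∀ {γ D} → IsDominationNumber G γ → Dominating G D → ∣ D ∣ ≡ γ →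
                              IsGammaSet G D
  minimum-dominating⇒γ-set (_ , γ-min) dom ∣D∣≡γ =
    dom , (_ , dom , refl) , λ D′ dom′ → subst (_≤ ∣ D′ ∣) (sym ∣D∣≡γ) (γ-min D′ dom′)

  outDeg≥2⇒Certified : ∀ {D} → Dominating G D → (∀ v → v ∈ D → outDeg G D v ≥ 2) →
                       Certified G D
  outDeg≥2⇒Certified dom out≥2 = dom , λ v v∈D → inj₂ (out≥2 v v∈D)

  certified-γ-set⇒outDeg≥2 : Connected G → 2 ≤ n → ∀ {D} → IsGammaSet G D → Certified G D →
                             ∀ v → v ∈ D → outDeg G D v ≥ 2
  certified-γ-set⇒outDeg≥2 conn n≥2 γ-set (_ , cert) v v∈D =
    [ (λ out≡0 → contradiction out≡0 (γ-set⇒outDeg≢0 γ-set v∈D (connected⇒neighbour conn n≥2 v)))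
    , id ]′ (cert v v∈D)

theorem2p1 : ∀ {n} (G : Graph n) → Connected G → 3 ≤ n →
    ∀ (γ γcer : ℕ) → IsDominationNumber G γ → IsCertifiedDominationNumber G γcer →
    (γ ≡ γcer ⇔
    Σ (Subset n) λ D → IsGammaSet G D × (∀ (v : Fin n) → v ∈ D → outDeg G D v ≥ 2))
theorem2p1 {n} G conn n≥3 γ γcer γ-num@((Dγ , domγ , ∣Dγ∣≡γ) , γ-min)
                                       ((Dc , Dc-cert , ∣Dc∣≡γcer) , γcer-min) =
  mk⇔ certified-γ-set (λ (D , γ-set , out≥2) → γ≡γcer γ-set out≥2)
  where
  certified-γ-set : γ ≡ γcer →
    Σ (Subset n) λ D → IsGammaSet G D × (∀ (v : Fin n) → v ∈ D → outDeg G D v ≥ 2)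
  certified-γ-set γ≡γcer = Dc , Dc-γ-set ,
    certified-γ-set⇒outDeg≥2 G conn (≤-trans (n≤1+n 2) n≥3) Dc-γ-set Dc-cert
    where
    Dc-γ-set : IsGammaSet G Dc
    Dc-γ-set = minimum-dominating⇒γ-set G γ-num (proj₁ Dc-cert) (trans ∣Dc∣≡γcer (sym γ≡γcer))

  γ≡γcer : ∀ {D} → IsGammaSet G D → (∀ v → v ∈ D → outDeg G D v ≥ 2) → γ ≡ γcer
  γ≡γcer {D} (dom , _ , D-min) out≥2 = ≤-antisym
    (subst (γ ≤_) ∣Dc∣≡γcer (γ-min Dc (proj₁ Dc-cert)))
    (≤-trans (γcer-min D (outDeg≥2⇒Certified G dom out≥2))
             (subst (∣ D ∣ ≤_) ∣Dγ∣≡γ (D-min Dγ domγ)))
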